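{- For every graph $G$, $\mathit{rankw}(G)\le\mathit{scw}(G)\le 2^{\mathit{rankw}(G)}$.
   Context: For a graph $G=(V,E)$, a decomposition tree is a pair $(T,\delta)$ where $T$ is a rooted binary tree and $\delta$ is a bijection from the leaves of $T$ to $V$. Each edge $e$ of $T$ induces a bipartition $(X,V\setminus X)$ of $V$, where $X$ is the $\delta$-image of the leaves of one component of $T-e$. The cut-rank $\rho_G(X)$ is the rank over $\mathbb{Z}_2$ of the submatrix of the adjacency matrix with rows $X$ and columns $V\setminus X$; $\mathit{rankw}(T,\delta)$ is the maximum of $\rho_G(X)$ over bipartitions induced by edges of $T$, and $\mathit{rankw}(G)$ is the minimum of $\mathit{rankw}(T,\delta)$ over all decomposition trees. For proper nonempty $X\subseteq V$, $x\equiv_X y$ iff for all $w\in V\setminus X$: $xw\in E\Leftrightarrow yw\in E$; $\mathit{index}_G(X)$ is the number of classes of $\equiv_X$, $\iota_G(X)=\max(\mathit{index}_G(X),\mathit{index}_G(V\setminus X))$; the index of $(T,\delta)$ is the maximum of $\iota_G(X)$ over bipartitions induced by edges of $T$, and the symmetric clique-width $\mathit{scw}(G)$ is the minimum index over all decomposition trees of $G$. -}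

module Defs where

open import Data.Nat using (ℕ; zero; suc; _≤_; _⊔_)
open import Data.Bool using (Bool; true; false; _∧_; _∨_; not; _xor_; if_then_else_)
open import Data.Fin using (Fin; zero; suc; _≟_; toℕ)
open import Data.Nat using (_<ᵇ_)
open import Data.List using (List; []; _∷_; _++_; map; foldr; length; filter)
open import Data.List.Membership.Propositional using (_∈_)
open import Data.List.Relation.Unary.Unique.Propositional using (Unique)
open import Data.Product using (_×_; Σ; ∃)
open import Relation.Binary.PropositionalEquality using (_≡_)
open import Relation.Nullary.Decidable using (⌊_⌋)

record Graph (n : ℕ) : Set where
  field
    adj    : Fin n → Fin n → Bool
    sym    : ∀ u v → adj u v ≡ adj v u
    irrefl : ∀ v → adj v v ≡ false
open Graph public

anyF : (n : ℕ) → (Fin n → Bool) → Bool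
anyF zero    p = false
anyF (suc n) p = p zero ∨ anyF n (λ i → p (suc i))

allF : (n : ℕ) → (Fin n → Bool) → Bool
allF n p = not (anyF n (λ i → not (p i)))

xorF : (n : ℕ) → (Fin n → Bool) → Bool
xorF zero    p = false
xorF (suc n) p = p zero xor xorF n (λ i → p (suc i))

countF : (n : ℕ) → (Fin n → Bool) → ℕ
countF zero    p = 0
countF (suc n) p = (if p zero then 1 else 0) Data.Nat.+ countF n (λ i → p (suc i))

Subset : ℕ → Set
Subset n = Fin n → Bool

allSubsets : (n : ℕ) → List (Subset n)
allSubsets zero    = (λ ()) ∷ []
allSubsets (suc n) =
  map (λ S → λ { zero → false ; (suc i) → S i }) (allSubsets n) ++
  map (λ S → λ { zero → true  ; (suc i) → S i }) (allSubsets n)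

maxList : List ℕ → ℕ
maxList = foldr _⊔_ 0

module _ {n : ℕ} (G : Graph n) (X : Subset n) where

  -- row of the submatrix A[X, V∖X] indexed by x, written as a vector
  -- indexed by all of V with zero entries outside the columns V∖X
  -- (zero columns do not change the rank)
  row : Fin n → Fin n → Bool
  row x w = adj G x w ∧ not (X w)

  rowSum : Subset n → Fin n → Bool
  rowSum T w = xorF n (λ x → T x ∧ row x w)

  -- the rows indexed by S (S ⊆ X) are linearly independent over Z₂:
  -- no nonempty subfamily sums to zero
  indepRows : Subset n → Bool
  indepRows S =
    allF n (λ x → not (S x) ∨ X x) ∧
    foldr (λ T b → b ∧ (not (allF n (λ x → not (T x) ∨ S x)) ∨
                        not (anyF n T) ∨
                        anyF n (rowSum T)))
          true (allSubsets n)

  -- cut-rank ρ_G(X): rank over Z₂ of A[X, V∖X]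
  -- = maximum number of linearly independent rows
  cutRank : ℕ
  cutRank = maxList (map (λ S → if indepRows S then countF n S else 0)
                         (allSubsets n))

module _ {n : ℕ} (G : Graph n) (X : Subset n) where

  -- x ≡_X y : same neighbourhood outside X
  equivX : Fin n → Fin n → Bool
  equivX x y = allF n (λ w → X w ∨ not (adj G x w xor adj G y w))

  -- number of ≡_X classes of X, counted by their least representatives
  index : ℕ
  index = countF n (λ x → X x ∧
            not (anyF n (λ y → X y ∧ (toℕ y <ᵇ toℕ x) ∧ equivX y x)))

complement : {n : ℕ} → Subset n → Subset n
complement X v = not (X v)

iota : {n : ℕ} → Graph n → Subset n → ℕ
iota G X = index G X ⊔ index G (complement X)

data BTree (n : ℕ) : Set where
  leaf : Fin n → BTree n
  node : BTree n → BTree n → BTree n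

leaves : {n : ℕ} → BTree n → List (Fin n)
leaves (leaf v)   = v ∷ []
leaves (node l r) = leaves l ++ leaves r

-- δ is a bijection from the leaves of T onto V
IsDecompositionTree : {n : ℕ} → BTree n → Set
IsDecompositionTree {n} T = Unique (leaves T) × (∀ (v : Fin n) → v ∈ leaves T)

-- the subtrees hanging below the edges of T (all proper subtrees);
-- each edge of T induces the bipartition (leaves of the lower side, rest)
edgeSubtrees : {n : ℕ} → BTree n → List (BTree n)
edgeSubtrees (leaf v)   = []
edgeSubtrees (node l r) = (l ∷ edgeSubtrees l) ++ (r ∷ edgeSubtrees r)

memberOf : {n : ℕ} → List (Fin n) → Subset n
memberOf []       v = false
memberOf (x ∷ xs) v = ⌊ x ≟ v ⌋ ∨ memberOf xs v

edgeSets : {n : ℕ} → BTree n → List (Subset n)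
edgeSets T = map (λ S → memberOf (leaves S)) (edgeSubtrees T)

-- rankw(T,δ) and the index of (T,δ) (maximum over edges; 0 if no edges)
rankwTree : {n : ℕ} → Graph n → BTree n → ℕ
rankwTree G T = maxList (map (cutRank G) (edgeSets T))

indexTree : {n : ℕ} → Graph n → BTree n → ℕ
indexTree G T = maxList (map (iota G) (edgeSets T))

IsMinOverTrees : {n : ℕ} → (BTree n → ℕ) → ℕ → Set
IsMinOverTrees f k =
  Σ _ (λ T → IsDecompositionTree T × f T ≡ k) ×
  (∀ T → IsDecompositionTree T → k ≤ f T)

IsRankWidth : {n : ℕ} → Graph n → ℕ → Set
IsRankWidth G = IsMinOverTrees (rankwTree G)

IsSymCliqueWidth : {n : ℕ} → Graph n → ℕ → Set
IsSymCliqueWidth G = IsMinOverTrees (indexTree G)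

module Submission where

-- Fix a bipartition (X, V∖X) and let ρ be the Z₂-rank of the rows of the
-- adjacency matrix indexed by X and restricted to the columns V∖X. Two vertices
-- of X are ≡_X-equivalent iff their rows coincide, so the rows of a basis lie in
-- pairwise distinct classes: ρ ≤ index(X). Conversely every row is the sum of a
-- subset of a basis B of ρ rows, so a class of X is determined by one of 2^ρ
-- subsets of B, and a class of V∖X by the adjacencies of its members to B:
-- index(X), index(V∖X) ≤ 2^ρ. Maximising over the edges of a tree that is
-- optimal for one width and comparing with the minimum of the other gives both
-- inequalities.

open import Defs hiding (sym)
open import Algebra.Bundles using (CommutativeRing)
open import Data.Bool using (Bool; true; false; _∧_; _∨_; not; _xor_; if_then_else_)
open import Data.Bool.Properties
  using (∧-conicalˡ; ∧-conicalʳ; ∧-identityʳ; ∧-zeroʳ; ∨-identityʳ; xor-identityʳ; xor-same;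
         ∧-distribʳ-xor; not-injective; ¬-not; T-≡; xor-∧-commutativeRing)
open import Algebra.Properties.CommutativeSemigroup
  (CommutativeRing.+-commutativeSemigroup xor-∧-commutativeRing) using (interchange)
open import Data.Empty using (⊥-elim)
open import Data.Fin using (Fin; zero; suc; toℕ; _≟_)
open import Data.Fin.Properties using (suc-injective; toℕ-injective; 0≢1+n)
open import Data.List using (List; []; _∷_; _++_; map; foldr; length)
open import Data.List.Properties using (length-map; length-++; ∷-injective)
open import Data.List.Membership.Propositional using (_∈_; find)
open import Data.List.Membership.Propositional.Properties using (∈-map⁺; ∈-map⁻; ∈-++⁺ˡ; ∈-++⁺ʳ)
open import Data.List.Relation.Unary.Any as Any using (Any; here; there)
open import Data.List.Relation.Unary.Any.Properties using (++⁺ˡ; ++⁺ʳ; map⁺)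
open import Data.Nat using (ℕ; zero; suc; _+_; _≤_; _<_; _^_; z≤n; s≤s; _<ᵇ_)
open import Data.Nat.Properties
  using (≤-trans; m≤m⊔n; m≤n⊔m; ⊔-lub; ⊔-sel; ^-monoʳ-≤; 1+n≰n; +-identityʳ;
         <⇒<ᵇ; <ᵇ⇒<; <-cmp; module ≤-Reasoning)
open import Data.Product using (∃; _×_; _,_; proj₁; proj₂)
import Data.Product as Product
open import Data.Sum using (_⊎_; inj₁; inj₂)
import Data.Sum as Sum
open import Function using (_∘_; id)
open import Function.Bundles using (Equivalence)
open import Relation.Binary.Definitions using (tri<; tri≈; tri>)
open import Relation.Binary.PropositionalEquality
  using (_≡_; _≢_; _≗_; refl; sym; trans; cong; cong₂; subst; module ≡-Reasoning)
open import Relation.Nullary using (¬_; does; yes; no; contradiction)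

private
  variable
    A : Set

true≢false : true ≢ false
true≢false ()

∧-true⇒ : ∀ {a b} → a ∧ b ≡ true → a ≡ true × b ≡ true
∧-true⇒ {true} {true} _ = refl , refl

∧-intro : ∀ {a b} → a ≡ true → b ≡ true → a ∧ b ≡ true
∧-intro refl refl = refl

∧-false⇒ : ∀ a {b} → a ∧ b ≡ false → a ≡ false ⊎ b ≡ false
∧-false⇒ false _ = inj₁ refl
∧-false⇒ true  e = inj₂ e

∨-true⇒ : ∀ a {b} → a ∨ b ≡ true → a ≡ true ⊎ b ≡ true
∨-true⇒ true  _ = inj₁ refl
∨-true⇒ false e = inj₂ e

not∨not∨-elim : ∀ a b {c} → not a ∨ not b ∨ c ≡ true → a ≡ true → b ≡ true → c ≡ true
not∨not∨-elim true true h _ _ = h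

not∨not∨-intro : ∀ a b {c} → (a ≡ true → b ≡ true → c ≡ true) → not a ∨ not b ∨ c ≡ true
not∨not∨-intro false _     _ = refl
not∨not∨-intro true  false _ = refl
not∨not∨-intro true  true  h = h refl refl

not∨not∨-false⇒ : ∀ a b {c} → not a ∨ not b ∨ c ≡ false → a ≡ true × b ≡ true × c ≡ false
not∨not∨-false⇒ true true h = refl , refl , h

⇒anyF-true : ∀ n p i → p i ≡ true → anyF n p ≡ true
⇒anyF-true (suc n) p zero    h rewrite h = refl
⇒anyF-true (suc n) p (suc i) h with p zero
... | true  = refl
... | false = ⇒anyF-true n (p ∘ suc) i h

anyF-true⇒ : ∀ n p → anyF n p ≡ true → ∃ λ i → p i ≡ true
anyF-true⇒ (suc n) p h with p zero in p0
... | true  = zero , p0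
... | false = Product.map suc id (anyF-true⇒ n (p ∘ suc) h)

⇒anyF-false : ∀ n p → (∀ i → p i ≡ false) → anyF n p ≡ false
⇒anyF-false zero    p h = refl
⇒anyF-false (suc n) p h rewrite h zero = ⇒anyF-false n (p ∘ suc) (h ∘ suc)

anyF-false⇒ : ∀ n p → anyF n p ≡ false → ∀ i → p i ≡ false
anyF-false⇒ n p h i = ¬-not λ pi → true≢false (trans (sym (⇒anyF-true n p i pi)) h)

⇒allF-true : ∀ n p → (∀ i → p i ≡ true) → allF n p ≡ true
⇒allF-true n p h = cong not (⇒anyF-false n (not ∘ p) (cong not ∘ h))

allF-true⇒ : ∀ n p → allF n p ≡ true → ∀ i → p i ≡ true
allF-true⇒ n p h i = not-injective (anyF-false⇒ n (not ∘ p) (not-injective h) i)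

allF-false⇒ : ∀ n p → allF n p ≡ false → ∃ λ i → p i ≡ false
allF-false⇒ n p h = Product.map₂ not-injective (anyF-true⇒ n (not ∘ p) (not-injective h))

xorF-cong : ∀ n {p q : Fin n → Bool} → p ≗ q → xorF n p ≡ xorF n q
xorF-cong zero    eq = refl
xorF-cong (suc n) eq = cong₂ _xor_ (eq zero) (xorF-cong n (eq ∘ suc))

xorF-false : ∀ n → xorF n (λ _ → false) ≡ false
xorF-false zero    = refl
xorF-false (suc n) = xorF-false n

xorF-xor : ∀ n p q → xorF n (λ i → p i xor q i) ≡ xorF n p xor xorF n q
xorF-xor zero    p q = refl
xorF-xor (suc n) p q =
  trans (cong ((p zero xor q zero) xor_) (xorF-xor n (p ∘ suc) (q ∘ suc)))
        (interchange (p zero) (q zero) _ _)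

countF-cong : ∀ n {p q : Fin n → Bool} → p ≗ q → countF n p ≡ countF n q
countF-cong zero    eq = refl
countF-cong (suc n) eq = cong₂ _+_ (cong (λ b → if b then 1 else 0) (eq zero)) (countF-cong n (eq ∘ suc))

countF-false : ∀ n → countF n (λ _ → false) ≡ 0
countF-false zero    = refl
countF-false (suc n) = countF-false n

least-witness : ∀ n (p : Fin n → Bool) i → p i ≡ true →
  ∃ λ j → p j ≡ true × (∀ k → toℕ k < toℕ j → p k ≡ false)
least-witness (suc n) p i h with p zero in p0
... | true = zero , p0 , λ _ ()
least-witness (suc n) p zero    h | false = ⊥-elim (true≢false (trans (sym h) p0))
least-witness (suc n) p (suc i) h | false with least-witness n (p ∘ suc) i h
... | j , pj , minimal = suc j , pj , λ { zero _ → p0 ; (suc k) (s≤s k<j) → minimal k k<j }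

singleton : ∀ {n} → Fin n → Subset n
singleton x i = does (x ≟ i)

singleton-refl : ∀ {n} (x : Fin n) → singleton x x ≡ true
singleton-refl x with x ≟ x
... | yes _  = refl
... | no x≢x = contradiction refl x≢x

singleton-true⇒ : ∀ {n} {x i : Fin n} → singleton x i ≡ true → x ≡ i
singleton-true⇒ {x = x} {i} h with x ≟ i
... | yes x≡i = x≡i

singleton-false : ∀ {n} {x i : Fin n} → x ≢ i → singleton x i ≡ false
singleton-false {x = x} {i} x≢i with x ≟ i
... | yes x≡i = contradiction x≡i x≢i
... | no _    = refl

xorF-singleton : ∀ n (x : Fin n) (f : Fin n → Bool) → xorF n (λ i → singleton x i ∧ f i) ≡ f x
xorF-singleton (suc n) zero f rewrite xorF-false n = xor-identityʳ (f zero)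
xorF-singleton (suc n) (suc x) f = xorF-singleton n x (f ∘ suc)

insert : ∀ {n} → Fin n → Subset n → Subset n
insert x S i = S i ∨ singleton x i

countF-insert : ∀ n (S : Subset n) x → S x ≡ false → countF n (insert x S) ≡ suc (countF n S)
countF-insert (suc n) S zero h rewrite h =
  cong suc (countF-cong n (λ i → ∨-identityʳ (S (suc i))))
countF-insert (suc n) S (suc x) h with S zero
... | true  = cong suc (countF-insert n (S ∘ suc) x h)
... | false = countF-insert n (S ∘ suc) x h

_⊆_ : ∀ {n} → Subset n → Subset n → Set
T ⊆ S = ∀ i → T i ≡ true → S i ≡ true

⊆⇒allF : ∀ n {S T : Subset n} → T ⊆ S → allF n (λ i → not (T i) ∨ S i) ≡ true
⊆⇒allF n {S} {T} T⊆S = ⇒allF-true n _ member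
  where
  member : ∀ i → not (T i) ∨ S i ≡ true
  member i with T i in Ti
  ... | false = refl
  ... | true  = T⊆S i Ti

pair-⊆ : ∀ {n} {S : Subset n} {x y} → S x ≡ true → S y ≡ true →
  (λ i → singleton x i xor singleton y i) ⊆ S
pair-⊆ {x = x} {y} Sx Sy i h with x ≟ i | y ≟ i
... | yes refl | _        = Sx
... | no _     | yes refl = Sy
... | no _     | no _     = contradiction h λ ()

allF⇒⊆ : ∀ n {S T : Subset n} → allF n (λ i → not (T i) ∨ S i) ≡ true → T ⊆ S
allF⇒⊆ n {S} {T} h i Ti with allF-true⇒ n _ h i
... | member rewrite Ti = member

allF-false⇒⊈ : ∀ n {S T : Subset n} → allF n (λ i → not (T i) ∨ S i) ≡ false →
  ∃ λ i → T i ≡ true × S i ≡ false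
allF-false⇒⊈ n {S} {T} h with allF-false⇒ n _ h
... | i , outside with T i in Ti
...   | true  = i , Ti , outside
...   | false = contradiction outside (λ ())

≗-on-superset : ∀ n {B T U : Subset n} → T ⊆ B → U ⊆ B → (∀ b → B b ≡ true → T b ≡ U b) → T ≗ U
≗-on-superset n {B} {T} {U} T⊆B U⊆B agree i with B i in Bi
... | true  = agree i Bi
... | false = trans (outside T⊆B) (sym (outside U⊆B))
  where
  outside : ∀ {W} → W ⊆ B → W i ≡ false
  outside W⊆B = ¬-not λ Wi → true≢false (trans (sym (W⊆B i Wi)) Bi)

allSubsets-complete : ∀ n (S : Subset n) → Any (S ≗_) (allSubsets n)
allSubsets-complete zero    S = here (λ ())
allSubsets-complete (suc n) S with S zero in S0
... | false = ++⁺ˡ (map⁺ (Any.map (λ S∘suc≗S′ → λ { zero → S0 ; (suc i) → S∘suc≗S′ i })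
                                  (allSubsets-complete n (S ∘ suc))))
... | true  = ++⁺ʳ _ (map⁺ (Any.map (λ S∘suc≗S′ → λ { zero → S0 ; (suc i) → S∘suc≗S′ i })
                                    (allSubsets-complete n (S ∘ suc))))

foldr-∧-true⇒ : ∀ (c : A → Bool) xs → foldr (λ x b → b ∧ c x) true xs ≡ true →
  ∀ {x} → x ∈ xs → c x ≡ true
foldr-∧-true⇒ c (x ∷ xs) h (here refl) = ∧-conicalʳ _ _ h
foldr-∧-true⇒ c (x ∷ xs) h (there x∈xs) = foldr-∧-true⇒ c xs (∧-conicalˡ _ _ h) x∈xs

⇒foldr-∧-true : ∀ (c : A → Bool) xs → (∀ x → c x ≡ true) → foldr (λ x b → b ∧ c x) true xs ≡ true
⇒foldr-∧-true c []       h = refl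
⇒foldr-∧-true c (x ∷ xs) h = ∧-intro (⇒foldr-∧-true c xs h) (h x)

foldr-∧-false⇒ : ∀ (c : A → Bool) xs → foldr (λ x b → b ∧ c x) true xs ≡ false → ∃ λ x → c x ≡ false
foldr-∧-false⇒ c (x ∷ xs) h with ∧-false⇒ (foldr (λ x b → b ∧ c x) true xs) h
... | inj₁ rest = foldr-∧-false⇒ c xs rest
... | inj₂ cx   = x , cx

elements : ∀ n → Subset n → List (Fin n)
elements zero    S = []
elements (suc n) S with S zero
... | true  = zero ∷ map suc (elements n (S ∘ suc))
... | false = map suc (elements n (S ∘ suc))

length-elements : ∀ n S → length (elements n S) ≡ countF n S
length-elements zero    S = refl
length-elements (suc n) S with S zero
... | true  = cong suc (trans (length-map suc (elements n (S ∘ suc))) (length-elements n (S ∘ suc)))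
... | false = trans (length-map suc (elements n (S ∘ suc))) (length-elements n (S ∘ suc))

∈-elements : ∀ n (S : Subset n) {i} → S i ≡ true → i ∈ elements n S
∈-elements (suc n) S {zero} h rewrite h = here refl
∈-elements (suc n) S {suc i} h with S zero
... | true  = there (∈-map⁺ suc (∈-elements n (S ∘ suc) h))
... | false = ∈-map⁺ suc (∈-elements n (S ∘ suc) h)

remove : ∀ {y} (ys : List A) → y ∈ ys → List A
remove (_ ∷ ys) (here _)     = ys
remove (y ∷ ys) (there y∈ys) = y ∷ remove ys y∈ys

length-remove : ∀ {y} (ys : List A) (y∈ys : y ∈ ys) → length ys ≡ suc (length (remove ys y∈ys))
length-remove (_ ∷ ys) (here _)     = refl
length-remove (_ ∷ ys) (there y∈ys) = cong suc (length-remove ys y∈ys)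

∈-remove : ∀ {x y} (ys : List A) → x ∈ ys → (y∈ys : y ∈ ys) → x ≢ y → x ∈ remove ys y∈ys
∈-remove (_ ∷ ys) (here refl) (here refl) x≢y = contradiction refl x≢y
∈-remove (_ ∷ ys) (there x∈ys) (here _)  x≢y = x∈ys
∈-remove (_ ∷ ys) (here refl) (there _)  x≢y = here refl
∈-remove (_ ∷ ys) (there x∈ys) (there y∈ys) x≢y = there (∈-remove ys x∈ys y∈ys x≢y)

countF-≤-length : ∀ n (S : Subset n) (ys : List A) (f : ∀ i → S i ≡ true → A) →
  (∀ i j (i∈S : S i ≡ true) (j∈S : S j ≡ true) → f i i∈S ≡ f j j∈S → i ≡ j) →
  (∀ i (i∈S : S i ≡ true) → f i i∈S ∈ ys) →
  countF n S ≤ length ys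
countF-≤-length zero    S ys f f-inj f∈ys = z≤n
countF-≤-length (suc n) S ys f f-inj f∈ys with S zero in S0
... | false = countF-≤-length n (S ∘ suc) ys (f ∘ suc)
                (λ i j i∈S j∈S → suc-injective ∘ f-inj (suc i) (suc j) i∈S j∈S) (f∈ys ∘ suc)
... | true  = begin
  suc (countF n (S ∘ suc))  ≤⟨ s≤s (countF-≤-length n (S ∘ suc) ys′ (f ∘ suc) f-inj′ f∈ys′) ⟩
  suc (length ys′)          ≡⟨ sym (length-remove ys f₀∈ys) ⟩
  length ys                 ∎
  where
  open ≤-Reasoning
  f₀∈ys = f∈ys zero S0
  ys′ = remove ys f₀∈ys
  f-inj′ : ∀ i j (i∈S : S (suc i) ≡ true) (j∈S : S (suc j) ≡ true) → f (suc i) i∈S ≡ f (suc j) j∈S → i ≡ j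
  f-inj′ i j i∈S j∈S = suc-injective ∘ f-inj (suc i) (suc j) i∈S j∈S
  f∈ys′ : ∀ i (i∈S : S (suc i) ≡ true) → f (suc i) i∈S ∈ ys′
  f∈ys′ i i∈S = ∈-remove ys (f∈ys (suc i) i∈S) f₀∈ys (0≢1+n ∘ sym ∘ f-inj (suc i) zero i∈S S0)

bitLists : ℕ → List (List Bool)
bitLists zero    = [] ∷ []
bitLists (suc k) = map (false ∷_) (bitLists k) ++ map (true ∷_) (bitLists k)

length-bitLists : ∀ k → length (bitLists k) ≡ 2 ^ k
length-bitLists zero    = refl
length-bitLists (suc k) = begin
  length (map (false ∷_) (bitLists k) ++ map (true ∷_) (bitLists k))
    ≡⟨ length-++ (map (false ∷_) (bitLists k)) ⟩
  length (map (false ∷_) (bitLists k)) + length (map (true ∷_) (bitLists k))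
    ≡⟨ cong₂ _+_ (length-map (false ∷_) (bitLists k)) (length-map (true ∷_) (bitLists k)) ⟩
  length (bitLists k) + length (bitLists k)
    ≡⟨ cong₂ _+_ (length-bitLists k) (trans (length-bitLists k) (sym (+-identityʳ (2 ^ k)))) ⟩
  2 ^ suc k
    ∎
  where open ≡-Reasoning

∈-bitLists : ∀ {k} (bs : List Bool) → length bs ≡ k → bs ∈ bitLists k
∈-bitLists []           refl = here refl
∈-bitLists (false ∷ bs) refl = ∈-++⁺ˡ (∈-map⁺ (false ∷_) (∈-bitLists bs refl))
∈-bitLists (true ∷ bs)  refl = ∈-++⁺ʳ _ (∈-map⁺ (true ∷_) (∈-bitLists bs refl))

map-≡⇒≡ : ∀ {B : Set} {f g : A → B} xs → map f xs ≡ map g xs → ∀ {x} → x ∈ xs → f x ≡ g x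
map-≡⇒≡ (_ ∷ xs) eq (here refl)  = proj₁ (∷-injective eq)
map-≡⇒≡ (_ ∷ xs) eq (there x∈xs) = map-≡⇒≡ xs (proj₂ (∷-injective eq)) x∈xs

countF-≤-2^countF : ∀ n (S B : Subset n) (label : ∀ i → S i ≡ true → Fin n → Bool) →
  (∀ i j (i∈S : S i ≡ true) (j∈S : S j ≡ true) →
     (∀ b → B b ≡ true → label i i∈S b ≡ label j j∈S b) → i ≡ j) →
  countF n S ≤ 2 ^ countF n B
countF-≤-2^countF n S B label separates = begin
  countF n S                     ≤⟨ countF-≤-length n S (bitLists (countF n B)) code code-injective code∈ ⟩
  length (bitLists (countF n B)) ≡⟨ length-bitLists (countF n B) ⟩
  2 ^ countF n B                 ∎
  where
  open ≤-Reasoning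
  code : ∀ i → S i ≡ true → List Bool
  code i i∈S = map (label i i∈S) (elements n B)
  code-injective : ∀ i j i∈S j∈S → code i i∈S ≡ code j j∈S → i ≡ j
  code-injective i j i∈S j∈S eq =
    separates i j i∈S j∈S (λ b b∈B → map-≡⇒≡ (elements n B) eq (∈-elements n B b∈B))
  code∈ : ∀ i i∈S → code i i∈S ∈ bitLists (countF n B)
  code∈ i i∈S = ∈-bitLists (code i i∈S) (trans (length-map _ (elements n B)) (length-elements n B))

maxList-attained : ∀ xs → maxList xs ≡ 0 ⊎ maxList xs ∈ xs
maxList-attained []       = inj₁ refl
maxList-attained (x ∷ xs) with ⊔-sel x (maxList xs)
... | inj₁ e = inj₂ (here e)
... | inj₂ e rewrite e = Sum.map₂ there (maxList-attained xs)

≤-maxList : ∀ {x} xs → x ∈ xs → x ≤ maxList xs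
≤-maxList (y ∷ xs) (here refl)  = m≤m⊔n y (maxList xs)
≤-maxList (y ∷ xs) (there x∈xs) = ≤-trans (≤-maxList xs x∈xs) (m≤n⊔m y (maxList xs))

maxList-map-≤ : (f g : A → ℕ) (h : ℕ → ℕ) → (∀ {a b} → a ≤ b → h a ≤ h b) →
  (∀ x → g x ≤ h (f x)) → ∀ xs → maxList (map g xs) ≤ h (maxList (map f xs))
maxList-map-≤ f g h h-mono g≤hf []       = z≤n
maxList-map-≤ f g h h-mono g≤hf (x ∷ xs) = ⊔-lub
  (≤-trans (g≤hf x) (h-mono (m≤m⊔n (f x) _)))
  (≤-trans (maxList-map-≤ f g h h-mono g≤hf xs) (h-mono (m≤n⊔m (f x) _)))

module _ {n : ℕ} (G : Graph n) where

  _≡[_]_ : Fin n → Subset n → Fin n → Set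
  x ≡[ Y ] y = ∀ w → Y w ≡ false → adj G x w ≡ adj G y w

  ≡[]-refl : ∀ {Y} x → x ≡[ Y ] x
  ≡[]-refl x w _ = refl

  ≡[]-sym : ∀ {Y x y} → x ≡[ Y ] y → y ≡[ Y ] x
  ≡[]-sym x≡y w w∉Y = sym (x≡y w w∉Y)

  ≡[]-trans : ∀ {Y x y z} → x ≡[ Y ] y → y ≡[ Y ] z → x ≡[ Y ] z
  ≡[]-trans x≡y y≡z w w∉Y = trans (x≡y w w∉Y) (y≡z w w∉Y)

  ⇒equivX-true : ∀ {Y x y} → x ≡[ Y ] y → equivX G Y x y ≡ true
  ⇒equivX-true {Y} {x} {y} x≡y = ⇒allF-true n _ agree
    where
    agree : ∀ w → Y w ∨ not (adj G x w xor adj G y w) ≡ true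
    agree w with Y w in Yw
    ... | true  = refl
    ... | false rewrite x≡y w Yw = cong not (xor-same (adj G y w))

  equivX-true⇒ : ∀ {Y x y} → equivX G Y x y ≡ true → x ≡[ Y ] y
  equivX-true⇒ {Y} {x} {y} h w Yw with allF-true⇒ n _ h w
  ... | agree rewrite Yw = xor≡false⇒ (adj G x w) (not-injective agree)
    where
    xor≡false⇒ : ∀ a {b} → a xor b ≡ false → a ≡ b
    xor≡false⇒ false e = sym e
    xor≡false⇒ true  e = sym (not-injective e)

  leastRep : Subset n → Subset n
  leastRep Y x = Y x ∧ not (anyF n (λ y → Y y ∧ (toℕ y <ᵇ toℕ x) ∧ equivX G Y y x))

  leastRep⇒∈ : ∀ Y x → leastRep Y x ≡ true → Y x ≡ true
  leastRep⇒∈ Y x = ∧-conicalˡ _ _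

  leastRep-minimal : ∀ Y x y → leastRep Y x ≡ true → Y y ≡ true → toℕ y < toℕ x → ¬ y ≡[ Y ] x
  leastRep-minimal Y x y rep y∈Y y<x y≡x =
    true≢false (trans (sym smaller-exists) (not-injective (∧-conicalʳ _ _ rep)))
    where
    smaller-exists = ⇒anyF-true n _ y
      (∧-intro y∈Y (∧-intro (Equivalence.to T-≡ (<⇒<ᵇ y<x)) (⇒equivX-true y≡x)))

  leastRep-injective : ∀ Y x y → leastRep Y x ≡ true → leastRep Y y ≡ true → x ≡[ Y ] y → x ≡ y
  leastRep-injective Y x y x-rep y-rep x≡y with <-cmp (toℕ x) (toℕ y)
  ... | tri< x<y _ _ = ⊥-elim (leastRep-minimal Y y x y-rep (leastRep⇒∈ Y x x-rep) x<y x≡y)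
  ... | tri≈ _ x≡y′ _ = toℕ-injective x≡y′
  ... | tri> _ _ y<x = ⊥-elim (leastRep-minimal Y x y x-rep (leastRep⇒∈ Y y y-rep) y<x (≡[]-sym x≡y))

  -- The least element of the class of x is a least representative.
  leastRep-exists : ∀ Y x → Y x ≡ true → ∃ λ z → leastRep Y z ≡ true × z ≡[ Y ] x
  leastRep-exists Y x x∈Y with least-witness n (λ y → Y y ∧ equivX G Y y x) x
                                     (∧-intro x∈Y (⇒equivX-true (≡[]-refl x)))
  ... | z , z-in-class , minimal =
    z , ∧-intro z∈Y (cong not (⇒anyF-false n _ no-smaller)) , z≡x
    where
    z∈Y = proj₁ (∧-true⇒ z-in-class)
    z≡x = equivX-true⇒ (proj₂ (∧-true⇒ {Y z} z-in-class))
    no-smaller : ∀ y → Y y ∧ (toℕ y <ᵇ toℕ z) ∧ equivX G Y y z ≡ false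
    no-smaller y = ¬-not λ h →
      let y∈Y , rest = ∧-true⇒ h
          y<z , y≡z = ∧-true⇒ rest
      in true≢false (trans (sym (∧-intro y∈Y (⇒equivX-true (≡[]-trans (equivX-true⇒ y≡z) z≡x))))
                           (minimal y (<ᵇ⇒< _ _ (Equivalence.from T-≡ y<z))))

  module _ (X : Subset n) where

    rowSum-cong : ∀ {T U} → T ≗ U → rowSum G X T ≗ rowSum G X U
    rowSum-cong T≗U w = xorF-cong n (λ i → cong (_∧ row G X i w) (T≗U i))

    rowSum-xor : ∀ T U w → rowSum G X (λ i → T i xor U i) w ≡ rowSum G X T w xor rowSum G X U w
    rowSum-xor T U w =
      trans (xorF-cong n (λ i → ∧-distribʳ-xor (row G X i w) (T i) (U i))) (xorF-xor n _ _)

    rowSum-singleton : ∀ x w → rowSum G X (singleton x) w ≡ row G X x w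
    rowSum-singleton x w = xorF-singleton n x (λ i → row G X i w)

    row-outside : ∀ x {w} → X w ≡ false → row G X x w ≡ adj G x w
    row-outside x {w} Xw rewrite Xw = ∧-identityʳ (adj G x w)

    row≗⇒≡[] : ∀ x y → row G X x ≗ row G X y → x ≡[ X ] y
    row≗⇒≡[] x y eq w Xw = trans (sym (row-outside x Xw)) (trans (eq w) (row-outside y Xw))

    ≡[]⇒row≗ : ∀ x y → x ≡[ X ] y → row G X x ≗ row G X y
    ≡[]⇒row≗ x y x≡y w with X w in Xw
    ... | true  = trans (∧-zeroʳ _) (sym (∧-zeroʳ _))
    ... | false = cong (_∧ true) (x≡y w Xw)

    Dependent : Subset n → Set
    Dependent T = (∃ λ i → T i ≡ true) × (∀ w → rowSum G X T w ≡ false)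

    Independent : Subset n → Set
    Independent S = S ⊆ X × (∀ T → T ⊆ S → ¬ Dependent T)

    Dependent-≗ : ∀ {T U} → T ≗ U → Dependent T → Dependent U
    Dependent-≗ T≗U ((i , Ti) , zero-sum) =
      (i , trans (sym (T≗U i)) Ti) , λ w → trans (sym (rowSum-cong T≗U w)) (zero-sum w)

    Independent-≗ : ∀ {S S′} → S ≗ S′ → Independent S → Independent S′
    Independent-≗ S≗S′ (S⊆X , no-dependent) =
      (λ i S′i → S⊆X i (trans (S≗S′ i) S′i)) ,
      (λ T T⊆S′ → no-dependent T (λ i Ti → trans (S≗S′ i) (T⊆S′ i Ti)))

    ∅-Independent : Independent (λ _ → false)
    ∅-Independent = (λ _ ()) , λ T T⊆∅ ((i , Ti) , _) → contradiction (T⊆∅ i Ti) λ ()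

    pair-Dependent : ∀ x y → x ≢ y → x ≡[ X ] y → Dependent (λ i → singleton x i xor singleton y i)
    pair-Dependent x y x≢y x≡y = (x , x∈pair) , zero-sum
      where
      x∈pair : singleton x x xor singleton y x ≡ true
      x∈pair rewrite singleton-refl x | singleton-false (x≢y ∘ sym) = refl
      zero-sum : ∀ w → rowSum G X (λ i → singleton x i xor singleton y i) w ≡ false
      zero-sum w = begin
        rowSum G X (λ i → singleton x i xor singleton y i) w
          ≡⟨ rowSum-xor (singleton x) (singleton y) w ⟩
        rowSum G X (singleton x) w xor rowSum G X (singleton y) w
          ≡⟨ cong₂ _xor_ (rowSum-singleton x w) (rowSum-singleton y w) ⟩
        row G X x w xor row G X y w
          ≡⟨ cong (_xor row G X y w) (≡[]⇒row≗ x y x≡y w) ⟩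
        row G X y w xor row G X y w
          ≡⟨ xor-same (row G X y w) ⟩
        false
          ∎
        where open ≡-Reasoning

    independenceCheck : Subset n → Subset n → Bool
    independenceCheck S T =
      not (allF n (λ i → not (T i) ∨ S i)) ∨ not (anyF n T) ∨ anyF n (rowSum G X T)

    independenceCheck-true⇒ : ∀ S T → independenceCheck S T ≡ true → T ⊆ S → ¬ Dependent T
    independenceCheck-true⇒ S T h T⊆S ((i , Ti) , zero-sum) = true≢false (trans
      (sym (not∨not∨-elim _ _ h (⊆⇒allF n T⊆S) (⇒anyF-true n T i Ti)))
      (⇒anyF-false n _ zero-sum))

    ⇒independenceCheck-true : ∀ S T → (T ⊆ S → ¬ Dependent T) → independenceCheck S T ≡ true
    ⇒independenceCheck-true S T no-dependent = not∨not∨-intro _ _ λ T⊆S T≢∅ →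
      ¬-not λ zero-sum →
        no-dependent (allF⇒⊆ n T⊆S) (anyF-true⇒ n T T≢∅ , anyF-false⇒ n _ zero-sum)

    independenceCheck-false⇒ : ∀ S T → independenceCheck S T ≡ false → T ⊆ S × Dependent T
    independenceCheck-false⇒ S T h with not∨not∨-false⇒ _ _ h
    ... | T⊆S , T≢∅ , zero-sum =
      allF⇒⊆ n T⊆S , anyF-true⇒ n T T≢∅ , anyF-false⇒ n _ zero-sum

    indepRows⇒Independent : ∀ S → indepRows G X S ≡ true → Independent S
    indepRows⇒Independent S h = allF⇒⊆ n (∧-conicalˡ _ _ h) , no-dependent
      where
      no-dependent : ∀ T → T ⊆ S → ¬ Dependent T
      no-dependent T T⊆S dep with find (allSubsets-complete n T)
      ... | T′ , T′∈ , T≗T′ = independenceCheck-true⇒ S T′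
        (foldr-∧-true⇒ (independenceCheck S) (allSubsets n) (∧-conicalʳ _ _ h) T′∈)
        (λ i T′i → T⊆S i (trans (T≗T′ i) T′i))
        (Dependent-≗ T≗T′ dep)

    Independent⇒indepRows : ∀ S → Independent S → indepRows G X S ≡ true
    Independent⇒indepRows S (S⊆X , no-dependent) = ∧-intro (⊆⇒allF n S⊆X)
      (⇒foldr-∧-true (independenceCheck S) (allSubsets n)
        (λ T → ⇒independenceCheck-true S T (no-dependent T)))

    indepRows-false⇒ : ∀ S → indepRows G X S ≡ false →
      (∃ λ i → S i ≡ true × X i ≡ false) ⊎ (∃ λ T → T ⊆ S × Dependent T)
    indepRows-false⇒ S h with ∧-false⇒ (allF n (λ i → not (S i) ∨ X i)) h
    ... | inj₁ S⊈X = inj₁ (allF-false⇒⊈ n S⊈X)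
    ... | inj₂ a-check-fails with foldr-∧-false⇒ (independenceCheck S) (allSubsets n) a-check-fails
    ...   | T , check-fails = inj₂ (T , independenceCheck-false⇒ S T check-fails)

    Independent⇒countF≤cutRank : ∀ S → Independent S → countF n S ≤ cutRank G X
    Independent⇒countF≤cutRank S S-indep with find (allSubsets-complete n S)
    ... | S′ , S′∈ , S≗S′ = begin
      countF n S                                   ≡⟨ countF-cong n S≗S′ ⟩
      countF n S′                                  ≡⟨ cong (λ b → if b then countF n S′ else 0) S′-indep ⟨
      (if indepRows G X S′ then countF n S′ else 0) ≤⟨ ≤-maxList _ (∈-map⁺ _ S′∈) ⟩
      cutRank G X                                  ∎
      where
      open ≤-Reasoning
      S′-indep = Independent⇒indepRows S′ (Independent-≗ S≗S′ S-indep)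

    basis-exists : ∃ λ B → Independent B × countF n B ≡ cutRank G X
    basis-exists with maxList-attained (map _ (allSubsets n))
    ... | inj₁ ρ≡0 = (λ _ → false) , ∅-Independent , trans (countF-false n) (sym ρ≡0)
    ... | inj₂ ρ∈ with ∈-map⁻ _ ρ∈
    ...   | S , _ , ρ≡ with indepRows G X S in S-indep
    ...     | true  = S , indepRows⇒Independent S S-indep , sym ρ≡
    ...     | false = (λ _ → false) , ∅-Independent , trans (countF-false n) (sym ρ≡)

    -- The rows of a basis lie in pairwise distinct classes.
    cutRank≤index : cutRank G X ≤ index G X
    cutRank≤index with basis-exists
    ... | B , (B⊆X , no-dependent) , B-size = begin
      cutRank G X
        ≡⟨ B-size ⟨
      countF n B
        ≤⟨ countF-≤-length n B (elements n (leastRep X)) rep rep-injective rep∈ ⟩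
      length (elements n (leastRep X))
        ≡⟨ length-elements n (leastRep X) ⟩
      index G X
        ∎
      where
      open ≤-Reasoning
      rep : ∀ x → B x ≡ true → Fin n
      rep x x∈B = proj₁ (leastRep-exists X x (B⊆X x x∈B))
      rep∈ : ∀ x x∈B → rep x x∈B ∈ elements n (leastRep X)
      rep∈ x x∈B = ∈-elements n (leastRep X) (proj₁ (proj₂ (leastRep-exists X x (B⊆X x x∈B))))
      rep≡ : ∀ x x∈B → rep x x∈B ≡[ X ] x
      rep≡ x x∈B = proj₂ (proj₂ (leastRep-exists X x (B⊆X x x∈B)))
      rep-injective : ∀ x y x∈B y∈B → rep x x∈B ≡ rep y y∈B → x ≡ y
      rep-injective x y x∈B y∈B eq with x ≟ y
      ... | yes x≡y = x≡y
      ... | no  x≢y = ⊥-elim (no-dependent _ (pair-⊆ x∈B y∈B) (pair-Dependent x y x≢y x≡[X]y))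
        where
        x≡[X]y : x ≡[ X ] y
        x≡[X]y = ≡[]-trans (≡[]-sym (rep≡ x x∈B)) (subst (_≡[ X ] y) (sym eq) (rep≡ y y∈B))

    module _ (B : Subset n) (B-indep : Independent B) (B-size : countF n B ≡ cutRank G X) where

      insert-Dependent : ∀ x → X x ≡ true → B x ≡ false → ∃ λ T → T ⊆ insert x B × Dependent T
      insert-Dependent x x∈X x∉B with indepRows G X (insert x B) in insert-indep
      ... | true  = ⊥-elim (1+n≰n (begin
        suc (cutRank G X)        ≡⟨ cong suc B-size ⟨
        suc (countF n B)         ≡⟨ countF-insert n B x x∉B ⟨
        countF n (insert x B)    ≤⟨ Independent⇒countF≤cutRank _ (indepRows⇒Independent _ insert-indep) ⟩
        cutRank G X              ∎))
        where open ≤-Reasoning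
      ... | false with indepRows-false⇒ (insert x B) insert-indep
      ...   | inj₂ dependent = dependent
      ...   | inj₁ (i , i∈B∪x , i∉X) with ∨-true⇒ (B i) i∈B∪x
      ...     | inj₁ i∈B = contradiction (trans (sym (proj₁ B-indep i i∈B)) i∉X) true≢false
      ...     | inj₂ x≡i =
        contradiction (trans (sym x∈X) (trans (cong X (singleton-true⇒ x≡i)) i∉X)) true≢false

      ⊆-insert⇒ : ∀ {T} x {i} → T ⊆ insert x B → T i ≡ true → x ≢ i → B i ≡ true
      ⊆-insert⇒ x {i} T⊆ Ti x≢i with ∨-true⇒ (B i) (T⊆ i Ti)
      ... | inj₁ Bi  = Bi
      ... | inj₂ x≡i = contradiction (singleton-true⇒ x≡i) x≢i

      -- If x ∉ B, then x lies in a dependent subset of B ∪ {x}, which expresses row x in B.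
      row-spanned : ∀ x → X x ≡ true → ∃ λ T → T ⊆ B × row G X x ≗ rowSum G X T
      row-spanned x x∈X with B x in Bx
      ... | true  = singleton x , (λ i xi → subst (λ j → B j ≡ true) (singleton-true⇒ xi) Bx) ,
                    λ w → sym (rowSum-singleton x w)
      ... | false with insert-Dependent x x∈X Bx
      ...   | T , T⊆ , dep@(_ , zero-sum) with T x in Tx
      ...     | false = ⊥-elim (proj₂ B-indep T T⊆B dep)
        where
        T⊆B : T ⊆ B
        T⊆B i Ti = ⊆-insert⇒ x T⊆ Ti λ { refl → true≢false (trans (sym Ti) Tx) }
      ...     | true  = (λ i → T i xor singleton x i) , T∖x⊆B , row≡
        where
        T∖x⊆B : (λ i → T i xor singleton x i) ⊆ B
        T∖x⊆B i h with x ≟ i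
        ... | yes refl = contradiction (trans (sym h) (cong (_xor true) Tx)) λ ()
        ... | no  x≢i  = ⊆-insert⇒ x T⊆ (trans (sym (xor-identityʳ (T i))) h) x≢i
        row≡ : row G X x ≗ rowSum G X (λ i → T i xor singleton x i)
        row≡ w = sym (begin
          rowSum G X (λ i → T i xor singleton x i) w
            ≡⟨ rowSum-xor T (singleton x) w ⟩
          rowSum G X T w xor rowSum G X (singleton x) w
            ≡⟨ cong₂ _xor_ (zero-sum w) (rowSum-singleton x w) ⟩
          row G X x w
            ∎)
          where open ≡-Reasoning

      index≤2^cutRank : index G X ≤ 2 ^ cutRank G X
      index≤2^cutRank = subst (λ k → index G X ≤ 2 ^ k) B-size
        (countF-≤-2^countF n (leastRep X) B coefficients separates)
        where
        coefficients : ∀ x → leastRep X x ≡ true → Subset n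
        coefficients x x-rep = proj₁ (row-spanned x (leastRep⇒∈ X x x-rep))
        separates : ∀ x y x-rep y-rep →
          (∀ b → B b ≡ true → coefficients x x-rep b ≡ coefficients y y-rep b) → x ≡ y
        separates x y x-rep y-rep agree with row-spanned x (leastRep⇒∈ X x x-rep)
                                          | row-spanned y (leastRep⇒∈ X y y-rep)
        ... | Tx , Tx⊆B , row-x | Ty , Ty⊆B , row-y =
          leastRep-injective X x y x-rep y-rep (row≗⇒≡[] x y λ w →
            trans (row-x w) (trans (rowSum-cong (≗-on-superset n Tx⊆B Ty⊆B agree) w) (sym (row-y w))))

      adj-determined : ∀ {c c′} → X c ≡ false → X c′ ≡ false →
        (∀ b → B b ≡ true → adj G b c ≡ adj G b c′) → ∀ w → X w ≡ true → adj G w c ≡ adj G w c′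
      adj-determined {c} {c′} Xc Xc′ agree w Xw with row-spanned w Xw
      ... | T , T⊆B , row≡ = begin
        adj G w c          ≡⟨ row-outside w Xc ⟨
        row G X w c        ≡⟨ row≡ c ⟩
        rowSum G X T c     ≡⟨ xorF-cong n column ⟩
        rowSum G X T c′    ≡⟨ row≡ c′ ⟨
        row G X w c′       ≡⟨ row-outside w Xc′ ⟩
        adj G w c′         ∎
        where
        open ≡-Reasoning
        column : ∀ i → T i ∧ row G X i c ≡ T i ∧ row G X i c′
        column i with T i in Ti
        ... | false = refl
        ... | true  = trans (row-outside i Xc) (trans (agree i (T⊆B i Ti)) (sym (row-outside i Xc′)))

      index-complement≤2^cutRank : index G (complement X) ≤ 2 ^ cutRank G X
      index-complement≤2^cutRank = subst (λ k → index G (complement X) ≤ 2 ^ k) B-size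
        (countF-≤-2^countF n (leastRep (complement X)) B (λ c _ b → adj G b c) separates)
        where
        separates : ∀ c c′ c-rep c′-rep → (∀ b → B b ≡ true → adj G b c ≡ adj G b c′) → c ≡ c′
        separates c c′ c-rep c′-rep agree =
          leastRep-injective (complement X) c c′ c-rep c′-rep λ w Xw →
            trans (Graph.sym G c w)
                  (trans (adj-determined Xc Xc′ agree w (not-injective Xw)) (Graph.sym G w c′))
          where
          Xc  = not-injective (leastRep⇒∈ (complement X) c c-rep)
          Xc′ = not-injective (leastRep⇒∈ (complement X) c′ c′-rep)

    cutRank≤iota : cutRank G X ≤ iota G X
    cutRank≤iota = ≤-trans cutRank≤index (m≤m⊔n _ _)

    iota≤2^cutRank : iota G X ≤ 2 ^ cutRank G X
    iota≤2^cutRank with basis-exists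
    ... | B , B-indep , B-size =
      ⊔-lub (index≤2^cutRank B B-indep B-size) (index-complement≤2^cutRank B B-indep B-size)

rankwTree≤indexTree : ∀ {n} (G : Graph n) T → rankwTree G T ≤ indexTree G T
rankwTree≤indexTree G T = maxList-map-≤ (iota G) (cutRank G) id id (cutRank≤iota G) (edgeSets T)

indexTree≤2^rankwTree : ∀ {n} (G : Graph n) T → indexTree G T ≤ 2 ^ rankwTree G T
indexTree≤2^rankwTree G T =
  maxList-map-≤ (cutRank G) (iota G) (2 ^_) (^-monoʳ-≤ 2) (iota≤2^cutRank G) (edgeSets T)

corollary1 : ∀ (n : ℕ) (G : Graph n) (r s : ℕ) →
    IsRankWidth G r → IsSymCliqueWidth G s → r ≤ s × s ≤ 2 ^ r
corollary1 n G _ _ ((Tr , Tr-tree , refl) , r-minimal) ((Ts , Ts-tree , refl) , s-minimal) =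
  ≤-trans (r-minimal Ts Ts-tree) (rankwTree≤indexTree G Ts) ,
  ≤-trans (s-minimal Tr Tr-tree) (indexTree≤2^rankwTree G Tr)
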